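{- Let $\mathbf{v}=(v_1,\dots,v_m)$ and $\mathbf{k}=(k_1,\dots,k_m)$ be $m$-tuples of positive integers with $\mathbf{v}\ge\mathbf{k}$, and let $\mathbf{w}=(w_1,\dots,w_n)$ and $\boldsymbol{\ell}=(\ell_1,\dots,\ell_n)$ be $n$-tuples of positive integers with $\mathbf{w}\ge\boldsymbol{\ell}$. Let $t\ge 1$ be an integer. Suppose there exists a generalized covering design ${\rm GC}(\mathbf{v},\mathbf{k},t)$ with $b$ blocks and a ${\rm GC}(\mathbf{w},\boldsymbol{\ell},t)$ with $c$ blocks. Then there exists a ${\rm GC}(\mathrm{cat}(\mathbf{v},\mathbf{w}),\mathrm{cat}(\mathbf{k},\boldsymbol{\ell}),t)$ with $bc$ blocks.
   Context: $\mathbf{x}\ge\mathbf{y}$ means componentwise. For tuples $\mathbf{a}=(a_1,\dots,a_p)$, $\mathbf{b}=(b_1,\dots,b_q)$, $\mathrm{cat}(\mathbf{a},\mathbf{b})=(a_1,\dots,a_p,b_1,\dots,b_q)$. Generalized covering designs: for $p$-tuples of positive integers $\mathbf{v}=(v_1,\dots,v_p)$, $\mathbf{k}=(k_1,\dots,k_p)$ with $k_i\le v_i$ and an integer $t$ with $1\le t\le \sum_i k_i$, let $X_1,\dots,X_p$ be pairwise disjoint sets with $|X_i|=v_i$. A block is a $p$-tuple $(B_1,\dots,B_p)$ with $B_i\subseteq X_i$, $|B_i|=k_i$. A $p$-tuple of sets $(T_1,\dots,T_p)$ is $(\mathbf{v},\mathbf{k},t)$-admissible if $T_i\subseteq X_i$,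 $|T_i|\le k_i$ and $\sum_i|T_i|=t$; it is contained in a block if $T_i\subseteq B_i$ for all $i$. A ${\rm GC}(\mathbf{v},\mathbf{k},t)$ is a family of blocks (repetitions allowed) such that every admissible tuple is contained in at least one block. -}

module Defs where

open import Data.Nat using (ℕ; zero; suc; _+_; _*_; _≤_)
open import Data.Fin using (Fin; zero; suc)
open import Data.Fin.Subset using (Subset; _⊆_; ∣_∣)
open import Data.Vec using (Vec; lookup; _++_)
open import Data.Product using (Σ; ∃; _×_; _,_)
open import Relation.Binary.PropositionalEquality using (_≡_)

sumFin : (p : ℕ) → (Fin p → ℕ) → ℕ
sumFin zero    f = 0
sumFin (suc p) f = f zero + sumFin p (λ i → f (suc i))

cat : ∀ {p q} → Vec ℕ p → Vec ℕ q → Vec ℕ (p + q)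
cat a b = a ++ b

_≥ᵛ_ : ∀ {p} → Vec ℕ p → Vec ℕ p → Set
_≥ᵛ_ {p} x y = (i : Fin p) → lookup y i ≤ lookup x i

Positive : ∀ {p} → Vec ℕ p → Set
Positive {p} x = (i : Fin p) → 1 ≤ lookup x i

-- The ground set X_i is modelled as Fin (v_i); the X_i are disjoint by
-- construction (a tuple of sets is indexed by i).

record Block {p : ℕ} (v k : Vec ℕ p) : Set where
  field
    set  : (i : Fin p) → Subset (lookup v i)
    size : (i : Fin p) → ∣ set i ∣ ≡ lookup k i
open Block public

SetTuple : ∀ {p} → Vec ℕ p → Set
SetTuple {p} v = (i : Fin p) → Subset (lookup v i)

Admissible : ∀ {p} (v k : Vec ℕ p) (t : ℕ) → SetTuple v → Set
Admissible {p} v k t T =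
  ((i : Fin p) → ∣ T i ∣ ≤ lookup k i) × sumFin p (λ i → ∣ T i ∣) ≡ t

ContainedIn : ∀ {p} {v k : Vec ℕ p} → SetTuple v → Block v k → Set
ContainedIn {p} T B = (i : Fin p) → T i ⊆ set B i

-- A GC(v,k,t) with exactly b blocks (a family indexed by Fin b, so
-- repetitions are allowed), together with the standing parameter
-- conditions of the definition: v, k positive, k ≤ v, 1 ≤ t ≤ Σ k_i.
record GC {p : ℕ} (v k : Vec ℕ p) (t : ℕ) (b : ℕ) : Set where
  field
    k-pos   : Positive k
    v≥k     : v ≥ᵛ k
    t-pos   : 1 ≤ t
    t≤Σk    : t ≤ sumFin p (lookup k)
    blocks  : Fin b → Block v k
    covers  : (T : SetTuple v) → Admissible v k t T →
              ∃ λ (j : Fin b) → ContainedIn T (blocks j)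

-- An admissible tuple T of the concatenated design splits into its first m and its last n
-- components. Each half has |T_i| bounded by the block sizes and total size at most t, and since
-- t ≤ Σ k_i it can be padded, one element at a time, to an admissible tuple of its factor design,
-- hence lies in a block of that design. Concatenating every block of the first design with every
-- block of the second gives bc blocks, one of which therefore contains T.
module Submission where

open import Defs
open import Data.Nat using (ℕ; zero; suc; _+_; _*_; _≤_; _<_; _<?_; s<s; z<s)
open import Data.Nat.Properties
open import Data.Vec using (Vec; []; _∷_; lookup; _++_)
import Data.Vec.Relation.Unary.All.Properties as All
import Data.Vec.Relation.Binary.Pointwise.Inductive as Pointwise
open import Data.Vec.Relation.Binary.Pointwise.Extensional using (ext; extensional⇒inductive)
open import Data.Fin using (Fin; zero; suc; combine; remQuot)
open import Data.Fin.Properties using (remQuot-combine)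
open import Data.Fin.Subset using (Subset; _⊆_; ∣_∣; inside; outside)
open import Data.Fin.Subset.Properties using (⊆-refl; ⊆-trans; out⊆; s⊆s)
open import Data.Product using (∃-syntax; _×_; _,_; uncurry)
open import Function using (_∘_)
open import Relation.Binary.PropositionalEquality using (_≡_; refl; sym; trans; cong; subst)
open import Relation.Nullary using (yes; no)

private
  variable
    m n p b c t x y : ℕ

grow-by-one : {S : Subset n} → ∣ S ∣ < n → ∃[ S′ ] S ⊆ S′ × ∣ S′ ∣ ≡ suc ∣ S ∣
grow-by-one {S = outside ∷ S} _ = inside ∷ S , out⊆ ⊆-refl , refl
grow-by-one {S = inside ∷ S} (s<s ∣S∣<n) with grow-by-one ∣S∣<n
... | S′ , S⊆S′ , ∣S′∣≡ = inside ∷ S′ , s⊆s S⊆S′ , cong suc ∣S′∣≡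

sumFin-++ : (k : Vec ℕ m) (ℓ : Vec ℕ n) →
            sumFin (m + n) (lookup (k ++ ℓ)) ≡ sumFin m (lookup k) + sumFin n (lookup ℓ)
sumFin-++ []      ℓ = refl
sumFin-++ (y ∷ k) ℓ = trans (cong (y +_) (sumFin-++ k ℓ)) (sym (+-assoc y _ _))

Positive-++ : (k : Vec ℕ m) (ℓ : Vec ℕ n) → Positive k → Positive ℓ → Positive (cat k ℓ)
Positive-++ k ℓ k>0 ℓ>0 =
  All.lookup⁺ (All.++⁺ (All.lookup⁻ {P = 1 ≤_} {xs = k} k>0) (All.lookup⁻ {P = 1 ≤_} {xs = ℓ} ℓ>0))

≥ᵛ-++ : (v k : Vec ℕ m) (w ℓ : Vec ℕ n) → v ≥ᵛ k → w ≥ᵛ ℓ → cat v w ≥ᵛ cat k ℓ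
≥ᵛ-++ v k w ℓ v≥k w≥ℓ = Pointwise.lookup (Pointwise.++⁺
  (extensional⇒inductive {_∼_ = _≤_} {xs = k} {v} (ext v≥k))
  (extensional⇒inductive {_∼_ = _≤_} {xs = ℓ} {w} (ext w≥ℓ)))

total : (v : Vec ℕ p) → SetTuple v → ℕ
total {p} v T = sumFin p (λ i → ∣ T i ∣)

Bounded : (v k : Vec ℕ p) → SetTuple v → Set
Bounded {p} v k T = (i : Fin p) → ∣ T i ∣ ≤ lookup k i

⊆ᵗ-syntax : (v : Vec ℕ p) → SetTuple v → SetTuple v → Set
⊆ᵗ-syntax {p} v T T′ = (i : Fin p) → T i ⊆ T′ i

syntax ⊆ᵗ-syntax v T T′ = T ⊆[ v ] T′

_∷ᵗ_ : {v : Vec ℕ p} → Subset x → SetTuple v → SetTuple (x ∷ v)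
(S ∷ᵗ T) zero    = S
(S ∷ᵗ T) (suc i) = T i

tailᵗ : (v : Vec ℕ p) → SetTuple (x ∷ v) → SetTuple v
tailᵗ v T i = T (suc i)

∷ᵗ-⊇ : (v : Vec ℕ p) (T : SetTuple (x ∷ v)) {S : Subset x} {T′ : SetTuple v} →
       T zero ⊆ S → tailᵗ v T ⊆[ v ] T′ → T ⊆[ x ∷ v ] (S ∷ᵗ T′)
∷ᵗ-⊇ v T T₀⊆S _     zero    = T₀⊆S
∷ᵗ-⊇ v T _    T⊆T′ (suc i) = T⊆T′ i

∷ᵗ-bounded : (v k : Vec ℕ p) {S : Subset x} {T : SetTuple v} →
             ∣ S ∣ ≤ y → Bounded v k T → Bounded (x ∷ v) (y ∷ k) (S ∷ᵗ T)
∷ᵗ-bounded v k ∣S∣≤y _    zero    = ∣S∣≤y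
∷ᵗ-bounded v k _     T≤k (suc i) = T≤k i

tail-slack : {s : ℕ} (v : Vec ℕ p) (T : SetTuple (x ∷ v)) →
             ∣ T zero ∣ ≡ y → total (x ∷ v) T < y + s → total v (tailᵗ v T) < s
tail-slack v T refl = +-cancelˡ-< _ _ _

pad-one : (v k : Vec ℕ p) → v ≥ᵛ k → (T : SetTuple v) → Bounded v k T →
          total v T < sumFin p (lookup k) →
          ∃[ T′ ] T ⊆[ v ] T′ × Bounded v k T′ × total v T′ ≡ suc (total v T)
pad-one (x ∷ v) (y ∷ k) v≥k T T≤k T<Σk with ∣ T zero ∣ <? y
... | yes ∣T₀∣<y with grow-by-one (≤-trans ∣T₀∣<y (v≥k zero))
...   | S , T₀⊆S , ∣S∣≡ =
  S ∷ᵗ tailᵗ v T , ∷ᵗ-⊇ v T T₀⊆S (λ _ → ⊆-refl) ,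
  ∷ᵗ-bounded v k (subst (_≤ y) (sym ∣S∣≡) ∣T₀∣<y) (T≤k ∘ suc) ,
  cong (_+ total v (tailᵗ v T)) ∣S∣≡
pad-one (x ∷ v) (y ∷ k) v≥k T T≤k T<Σk | no ∣T₀∣≮y
  with pad-one v k (v≥k ∘ suc) (tailᵗ v T) (T≤k ∘ suc)
         (tail-slack v T (≤-antisym (T≤k zero) (≮⇒≥ ∣T₀∣≮y)) T<Σk)
... | T′ , T⊆T′ , T′≤k , total≡ =
  T zero ∷ᵗ T′ , ∷ᵗ-⊇ v T ⊆-refl T⊆T′ , ∷ᵗ-bounded v k (T≤k zero) T′≤k ,
  trans (cong (∣ T zero ∣ +_) total≡) (+-suc _ _)

pad : (v k : Vec ℕ p) → v ≥ᵛ k → (T : SetTuple v) → Bounded v k T →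
      total v T ≤ t → t ≤ sumFin p (lookup k) → ∃[ T′ ] T ⊆[ v ] T′ × Admissible v k t T′
pad {t = t} v k v≥k T T≤k T≤t t≤Σk = let d , eq = m≤n⇒∃[o]m+o≡n T≤t in go d T T≤k eq
  where
  go : ∀ d (T : SetTuple v) → Bounded v k T → total v T + d ≡ t →
       ∃[ T′ ] T ⊆[ v ] T′ × Admissible v k t T′
  go zero    T T≤k eq = T , (λ _ → ⊆-refl) , T≤k , trans (sym (+-identityʳ _)) eq
  go (suc d) T T≤k eq
    with pad-one v k v≥k T T≤k (<-≤-trans (subst (_ <_) eq (m<m+n _ z<s)) t≤Σk)
  ... | T₁ , T⊆T₁ , T₁≤k , total≡
    with go d T₁ T₁≤k (trans (cong (_+ d) total≡) (trans (sym (+-suc _ d)) eq))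
  ... | T′ , T₁⊆T′ , adm = T′ , (λ i → ⊆-trans (T⊆T₁ i) (T₁⊆T′ i)) , adm

covered-by-block : {v k : Vec ℕ p} (G : GC v k t b) (T : SetTuple v) → Bounded v k T →
                   total v T ≤ t → ∃[ j ] ContainedIn T (GC.blocks G j)
covered-by-block {v = v} {k} G T T≤k T≤t with pad v k (GC.v≥k G) T T≤k T≤t (GC.t≤Σk G)
... | T′ , T⊆T′ , adm with GC.covers G T′ adm
...   | j , T′⊆Bⱼ = j , λ i → ⊆-trans (T⊆T′ i) (T′⊆Bⱼ i)

takeᵗ : (v : Vec ℕ m) (w : Vec ℕ n) → SetTuple (v ++ w) → SetTuple v
takeᵗ []      w T ()
takeᵗ (x ∷ v) w T = T zero ∷ᵗ takeᵗ v w (tailᵗ (v ++ w) T)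

dropᵗ : (v : Vec ℕ m) (w : Vec ℕ n) → SetTuple (v ++ w) → SetTuple w
dropᵗ []      w T = T
dropᵗ (x ∷ v) w T = dropᵗ v w (tailᵗ (v ++ w) T)

appendᵗ : (v : Vec ℕ m) (w : Vec ℕ n) → SetTuple v → SetTuple w → SetTuple (v ++ w)
appendᵗ []      w A B = B
appendᵗ (x ∷ v) w A B = A zero ∷ᵗ appendᵗ v w (tailᵗ v A) B

total-split : (v : Vec ℕ m) (w : Vec ℕ n) (T : SetTuple (v ++ w)) →
              total (v ++ w) T ≡ total v (takeᵗ v w T) + total w (dropᵗ v w T)
total-split []      w T = refl
total-split (x ∷ v) w T =
  trans (cong (∣ T zero ∣ +_) (total-split v w (tailᵗ (v ++ w) T))) (sym (+-assoc ∣ T zero ∣ _ _))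

takeᵗ-bounded : (v k : Vec ℕ m) (w ℓ : Vec ℕ n) (T : SetTuple (v ++ w)) →
                Bounded (v ++ w) (k ++ ℓ) T → Bounded v k (takeᵗ v w T)
takeᵗ-bounded (x ∷ v) (y ∷ k) w ℓ T T≤kℓ =
  ∷ᵗ-bounded v k (T≤kℓ zero) (takeᵗ-bounded v k w ℓ (tailᵗ (v ++ w) T) (T≤kℓ ∘ suc))

dropᵗ-bounded : (v k : Vec ℕ m) (w ℓ : Vec ℕ n) (T : SetTuple (v ++ w)) →
                Bounded (v ++ w) (k ++ ℓ) T → Bounded w ℓ (dropᵗ v w T)
dropᵗ-bounded []      []      w ℓ T T≤kℓ = T≤kℓ
dropᵗ-bounded (x ∷ v) (y ∷ k) w ℓ T T≤kℓ = dropᵗ-bounded v k w ℓ (tailᵗ (v ++ w) T) (T≤kℓ ∘ suc)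

appendᵗ-sizes : (v k : Vec ℕ m) (w ℓ : Vec ℕ n) (A : SetTuple v) (B : SetTuple w) →
                (∀ i → ∣ A i ∣ ≡ lookup k i) → (∀ i → ∣ B i ∣ ≡ lookup ℓ i) →
                ∀ i → ∣ appendᵗ v w A B i ∣ ≡ lookup (k ++ ℓ) i
appendᵗ-sizes []      []      w ℓ A B ∣A∣≡k ∣B∣≡ℓ i       = ∣B∣≡ℓ i
appendᵗ-sizes (x ∷ v) (y ∷ k) w ℓ A B ∣A∣≡k ∣B∣≡ℓ zero    = ∣A∣≡k zero
appendᵗ-sizes (x ∷ v) (y ∷ k) w ℓ A B ∣A∣≡k ∣B∣≡ℓ (suc i) =
  appendᵗ-sizes v k w ℓ (tailᵗ v A) B (∣A∣≡k ∘ suc) ∣B∣≡ℓ i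

appendᵗ-⊇ : (v : Vec ℕ m) (w : Vec ℕ n) (T : SetTuple (v ++ w)) {A : SetTuple v} {B : SetTuple w} →
            takeᵗ v w T ⊆[ v ] A → dropᵗ v w T ⊆[ w ] B → T ⊆[ v ++ w ] appendᵗ v w A B
appendᵗ-⊇ []      w T Tˡ⊆A Tʳ⊆B = Tʳ⊆B
appendᵗ-⊇ (x ∷ v) w T Tˡ⊆A Tʳ⊆B =
  ∷ᵗ-⊇ (v ++ w) T (Tˡ⊆A zero) (appendᵗ-⊇ v w (tailᵗ (v ++ w) T) (Tˡ⊆A ∘ suc) Tʳ⊆B)

_++ᴮ_ : {v k : Vec ℕ m} {w ℓ : Vec ℕ n} → Block v k → Block w ℓ → Block (cat v w) (cat k ℓ)
_++ᴮ_ {v = v} {k} {w} {ℓ} B C = record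
  { set  = appendᵗ v w (set B) (set C)
  ; size = appendᵗ-sizes v k w ℓ (set B) (set C) (size B) (size C)
  }

productBlocks : {v k : Vec ℕ m} {w ℓ : Vec ℕ n} →
                (Fin b → Block v k) → (Fin c → Block w ℓ) → Fin (b * c) → Block (cat v w) (cat k ℓ)
productBlocks {c = c} B C = uncurry (λ a d → B a ++ᴮ C d) ∘ remQuot c

productBlocks-combine : {v k : Vec ℕ m} {w ℓ : Vec ℕ n}
                        (B : Fin b → Block v k) (C : Fin c → Block w ℓ) (a : Fin b) (d : Fin c) →
                        productBlocks B C (combine a d) ≡ B a ++ᴮ C d
productBlocks-combine B C a d = cong (uncurry (λ a d → B a ++ᴮ C d)) (remQuot-combine a d)

productBlocks-covers : {v k : Vec ℕ m} {w ℓ : Vec ℕ n} (G : GC v k t b) (H : GC w ℓ t c) →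
                       (T : SetTuple (cat v w)) → Admissible (cat v w) (cat k ℓ) t T →
                       ∃[ j ] ContainedIn T (productBlocks (GC.blocks G) (GC.blocks H) j)
productBlocks-covers {t = t} {v = v} {k} {w} {ℓ} G H T (T≤kℓ , total≡t)
  with covered-by-block G (takeᵗ v w T) (takeᵗ-bounded v k w ℓ T T≤kℓ) (≤-trans (m≤m+n _ _) split≤t)
     | covered-by-block H (dropᵗ v w T) (dropᵗ-bounded v k w ℓ T T≤kℓ) (≤-trans (m≤n+m _ _) split≤t)
  where
  split≤t : total v (takeᵗ v w T) + total w (dropᵗ v w T) ≤ t
  split≤t = ≤-reflexive (trans (sym (total-split v w T)) total≡t)
... | a , Tˡ⊆Bₐ | d , Tʳ⊆Cd =
  combine a d ,
  subst (ContainedIn T) (sym (productBlocks-combine (GC.blocks G) (GC.blocks H) a d))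
    (appendᵗ-⊇ v w T Tˡ⊆Bₐ Tʳ⊆Cd)

-- The positivity and v ≥ k hypotheses on the factors are already fields of GC.
theorem6p1 : {m n : ℕ} (v k : Vec ℕ m) (w ℓ : Vec ℕ n) (t b c : ℕ) →
    Positive v → Positive k → v ≥ᵛ k →
    Positive w → Positive ℓ → w ≥ᵛ ℓ →
    1 ≤ t →
    GC v k t b → GC w ℓ t c →
    GC (cat v w) (cat k ℓ) t (b * c)
theorem6p1 v k w ℓ t b c _ _ _ _ _ _ t≥1 G H = record
  { k-pos  = Positive-++ k ℓ (GC.k-pos G) (GC.k-pos H)
  ; v≥k    = ≥ᵛ-++ v k w ℓ (GC.v≥k G) (GC.v≥k H)
  ; t-pos  = t≥1
  ; t≤Σk   = ≤-trans (GC.t≤Σk G) (≤-trans (m≤m+n _ _) (≤-reflexive (sym (sumFin-++ k ℓ))))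
  ; blocks = productBlocks (GC.blocks G) (GC.blocks H)
  ; covers = productBlocks-covers G H
  }
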